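{- Let $M=(E,\rho)$ be a matroid of rank $d\ge 0$. Then $$\widehat{Y}_M(p,t)=\sum_{i=0}^{d-1}W_i^M(p)\,p^{d-1-i}\,t^i.$$
   Context: A matroid $M=(E,\rho)$ has finite ground set $E$, rank function $\rho$, rank $d(M)=\rho(E)$, and corank function $\sigma(S)=\#S-\rho(S)$. The Tutte polynomial is $T_M(x,y)=\sum_{S\subseteq E}(x-1)^{\rho(E)-\rho(S)}(y-1)^{\sigma(S)}$. Define $Y_M(q,t):=(1-q)^{\rho(E)}q^{\sigma(E)}T_M\!\left(\frac{qt+1-q}{1-q},\frac1q\right)$ and $\widehat{Y}_M(p,t):=\frac{(-1)^{d(M)}Y_M(1+p,-t)-t^{d(M)}}{1+t}$. For $d\ge1$ and $0\le i\le d-1$, let $\mathcal{S}_i^M=\{S\subseteq E:\rho(S)\ge d-i\}$ ordered by inclusion, $\mathcal{L}_i^M=\{\hat0\}\oplus\mathcal{S}_i^M$ (new minimum adjoined), $\mu_i^M(S)$ the Möbius function $\mu(\hat0,S)$ of $\mathcal{L}_i^M$, and $$W_i^M(p):=\sum_{S\in\mathcal{S}_i^M}\mu_i^M(S)(-p)^{\#S-d+1+i}.$$ (When $d=0$ the sum in the claim is empty.) -}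

module Defs where

open import Data.Nat as ℕ using (ℕ; zero; suc; _∸_; _≤?_)
import Data.Nat.Properties as ℕP
open import Data.Integer as ℤ using (ℤ)
open import Data.Rational as ℚ using (ℚ; 0ℚ; 1ℚ; _+_; _*_; _-_; -_; 1/_; _÷_; ≢-nonZero)
open import Data.Fin using (Fin)
open import Data.Fin.Subset using (Subset; _⊆_; _⊂_; _∪_; _∩_; ∣_∣; ⊤)
open import Data.Fin.Subset.Properties using (_⊂?_)
open import Data.Vec using (Vec; []; _∷_)
open import Data.Bool using (true; false)
open import Data.List using (List; []; _∷_; _++_; map; upTo; foldr)
open import Relation.Binary.PropositionalEquality using (_≡_; _≢_)
open import Relation.Nullary using (yes; no)

record Matroid (n : ℕ) : Set where
  field
    ρ          : Subset n → ℕ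
    ρ-bounded  : ∀ S → ρ S ℕ.≤ ∣ S ∣
    ρ-mono     : ∀ {S T} → S ⊆ T → ρ S ℕ.≤ ρ T
    ρ-submod   : ∀ S T → ρ (S ∪ T) ℕ.+ ρ (S ∩ T) ℕ.≤ ρ S ℕ.+ ρ T

open Matroid public

rk : ∀ {n} → Matroid n → ℕ
rk M = ρ M ⊤

-- corank σ(S) = #S − ρ(S)   (ρ(S) ≤ #S, so truncated subtraction is exact)
σ : ∀ {n} → Matroid n → Subset n → ℕ
σ M S = ∣ S ∣ ∸ ρ M S

Σℚ : ∀ {a} {A : Set a} → List A → (A → ℚ) → ℚ
Σℚ xs f = foldr (λ x acc → f x + acc) 0ℚ xs

infixr 8 _^_
_^_ : ℚ → ℕ → ℚ
x ^ zero  = 1ℚ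
x ^ suc k = x * (x ^ k)

ℤ→ℚ : ℤ → ℚ
ℤ→ℚ z = z ℚ./ 1

subsets : ∀ n → List (Subset n)
subsets zero    = [] ∷ []
subsets (suc n) = map (false ∷_) (subsets n) ++ map (true ∷_) (subsets n)

tutte : ∀ {n} → Matroid n → ℚ → ℚ → ℚ
tutte {n} M x y =
  Σℚ (subsets n) λ S → ((x - 1ℚ) ^ (rk M ∸ ρ M S)) * ((y - 1ℚ) ^ σ M S)

Y : ∀ {n} → Matroid n → (q t : ℚ) → q ≢ 0ℚ → (1ℚ - q) ≢ 0ℚ → ℚ
Y {n} M q t q≢0 1-q≢0 =
  ((1ℚ - q) ^ rk M) * (q ^ σ M ⊤) *
  tutte M (_÷_ (q * t + 1ℚ - q) (1ℚ - q) {{≢-nonZero 1-q≢0}})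
          (1/_ q {{≢-nonZero q≢0}})

Yhat : ∀ {n} → Matroid n → (p t : ℚ) →
       (1ℚ + p) ≢ 0ℚ → (1ℚ - (1ℚ + p)) ≢ 0ℚ → (1ℚ + t) ≢ 0ℚ → ℚ
Yhat M p t h₁ h₂ h₃ =
  _÷_ ((((- 1ℚ) ^ rk M) * Y M (1ℚ + p) (- t) h₁ h₂) - (t ^ rk M))
      (1ℚ + t) {{≢-nonZero h₃}}

-- The posets S_i^M = {S ⊆ E : ρ(S) ≥ d − i} (ordered by inclusion) and
-- L_i^M = {0̂} ⊕ S_i^M.  μ_i^M(S) = μ(0̂, S) in L_i^M, computed by the
-- defining recursion of the Möbius function:
--   μ(0̂,0̂) = 1,   μ(0̂,S) = − Σ_{0̂ ≤ Z < S} μ(0̂,Z)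
--                           = − (1 + Σ_{T ∈ S_i, T ⊊ S} μ(0̂,T)).
-- A fuel argument bounds the recursion depth; fuel n+1 suffices since the
-- cardinality strictly decreases along the recursion (fuel k ≥ #S+1 is
-- preserved).  The value is set to 0 outside S_i^M (never used there).

module _ {n : ℕ} (M : Matroid n) (i : ℕ) where

  inS : Subset n → Set
  inS S = rk M ∸ i ℕ.≤ ρ M S

  μ-fuel : ℕ → Subset n → ℤ
  μ-fuel zero    S = ℤ.0ℤ
  μ-fuel (suc k) S with rk M ∸ i ≤? ρ M S
  ... | no  _ = ℤ.0ℤ
  ... | yes _ = ℤ.- (ℤ.1ℤ ℤ.+ sumLower (subsets n))
    where
    sumLower : List (Subset n) → ℤ
    sumLower []       = ℤ.0ℤ
    sumLower (T ∷ Ts) with T ⊂? S | rk M ∸ i ≤? ρ M T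
    ... | yes _ | yes _ = μ-fuel k T ℤ.+ sumLower Ts
    ... | _     | _     = sumLower Ts

  μ : Subset n → ℤ
  μ S = μ-fuel (suc n) S

  -- W_i^M(p) = Σ_{S ∈ S_i^M} μ_i^M(S) (−p)^{#S − d + 1 + i}
  -- (for S ∈ S_i^M, #S ≥ ρ(S) ≥ d − i, so the exponent #S + 1 + i − d is
  -- a natural number and truncated subtraction is exact)
  W : ℚ → ℚ
  W p = Σℚ (subsets n) λ S → term S (rk M ∸ i ≤? ρ M S)
    where
    term : (S : Subset n) → _ → ℚ
    term S (yes _) = ℤ→ℚ (μ S) * ((- p) ^ ((∣ S ∣ ℕ.+ 1 ℕ.+ i) ∸ rk M))
    term S (no  _) = 0ℚ

RHS : ∀ {n} → Matroid n → ℚ → ℚ → ℚ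
RHS M p t = Σℚ (upTo (rk M)) λ i →
  W M i p * (p ^ (rk M ∸ 1 ∸ i)) * (t ^ i)

{-# OPTIONS --safe #-}
-- Expanding the Tutte polynomial over subsets gives
--   (-1)^d Y_M(1+p, -t) = Σ_S (-1)^ρ(S) t^(d-ρ(S)) g(S),   g(S) = (-p)^|S| (1+p)^(n-|S|),
-- where Σ_S g(S) = 1.  On the other side, the recursion defining μ_i^M says that
-- Σ_{U ⊆ T} μ_i^M(U) = -[T ∈ S_i^M]; since Σ_{T ⊇ U} g(T) = (-p)^|U|, summing it against g gives
--   W_i^M(p) p^(d-1-i) = (-1)^(d-i) Σ_{S ∈ S_i^M} g(S).
-- Exchanging the sums over i and S in the right-hand side, the coefficient of g(S) is
-- Σ_{i<d, d-i ≤ ρ(S)} (-1)^(d-i) t^i, and multiplying by 1+t telescopes it to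
-- (-1)^ρ(S) t^(d-ρ(S)) - t^d.

module Submission where

open import Defs
open import Data.Nat using (ℕ)
open import Data.Rational using (ℚ; 0ℚ; 1ℚ; _+_; _-_)
open import Relation.Binary.PropositionalEquality using (_≡_; _≢_)

open import Data.Bool using (true; false; if_then_else_)
open import Data.Empty using (⊥-elim)
open import Data.Fin.Subset using (Subset; _⊂_; ∣_∣; ⊤; ∁; _∪_)
open import Data.Fin.Subset.Properties
  using (_⊆?_; _⊂?_; ∣p∣≤n; ⊆⊤; p⊂q⇒∣p∣<∣q∣; p∪∁p≡⊤; ∣∁p∣≡n∸∣p∣; ∣⊤∣≡n)
open import Data.Integer as ℤ using (ℤ)
import Data.Integer.Properties as ℤP
open import Data.List using (List; []; _∷_; _++_; map; upTo)
open import Data.List.Membership.Propositional using (_∈_)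
open import Data.List.Membership.Propositional.Properties using (∈-upTo⁻)
open import Data.List.Properties using (map-applyUpTo)
open import Data.List.Relation.Unary.Any using (here; there)
open import Data.Nat as ℕ using (zero; suc; _∸_; _≤?_)
import Data.Nat.Coprimality as Coprime
import Data.Nat.Properties as ℕP
open import Data.Sum using (inj₁; inj₂)
open import Data.Rational as ℚ using (_*_; -_; 1/_; _÷_; ≢-nonZero; mkℚ)
import Data.Rational.Properties as ℚP
open import Data.Rational.Solver using (module +-*-Solver)
open import Data.Vec using ([]; _∷_)
open import Function using (_∘_)
open import Relation.Binary.PropositionalEquality
  using (refl; sym; trans; cong; cong₂; subst; module ≡-Reasoning)
open import Relation.Nullary using (Dec; yes; no; does; ¬_)
open import Relation.Nullary.Decidable using (dec-true; dec-false)

open import Algebra.Properties.CommutativeSemigroup ℕP.+-commutativeSemigroup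
  using () renaming (interchange to +-interchange)

open +-*-Solver using (solve; _:+_; _:*_; :-_; _:-_; _:=_; con)

[x*y]*1/x≡y : ∀ x y .{{_ : ℚ.NonZero x}} → (x * y) * 1/ x ≡ y
[x*y]*1/x≡y x y = begin
  (x * y) * 1/ x   ≡⟨ solve 3 (λ x y z → (x :* y) :* z := y :* (x :* z)) refl x y (1/ x) ⟩
  y * (x * 1/ x)   ≡⟨ cong (y *_) (ℚP.*-inverseʳ x) ⟩
  y * 1ℚ           ≡⟨ ℚP.*-identityʳ y ⟩
  y                ∎
  where open ≡-Reasoning

x≡0⇒x+y≡y : ∀ {x} y → x ≡ 0ℚ → x + y ≡ y
x≡0⇒x+y≡y y refl = ℚP.+-identityˡ y

-p+[1+p]≡1 : ∀ p → - p + (1ℚ + p) ≡ 1ℚ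
-p+[1+p]≡1 p = solve 1 (λ p → :- p :+ (con 1ℚ :+ p) := con 1ℚ) refl p

module _ {a} {A : Set a} where

  Σ-cong : ∀ xs {f g : A → ℚ} → (∀ x → f x ≡ g x) → Σℚ xs f ≡ Σℚ xs g
  Σ-cong []       f≡g = refl
  Σ-cong (x ∷ xs) f≡g = cong₂ _+_ (f≡g x) (Σ-cong xs f≡g)

  Σ-cong-∈ : ∀ xs {f g : A → ℚ} → (∀ {x} → x ∈ xs → f x ≡ g x) → Σℚ xs f ≡ Σℚ xs g
  Σ-cong-∈ []       f≡g = refl
  Σ-cong-∈ (x ∷ xs) f≡g = cong₂ _+_ (f≡g (here refl)) (Σ-cong-∈ xs (f≡g ∘ there))

  Σ-zero : ∀ xs {f : A → ℚ} → (∀ x → f x ≡ 0ℚ) → Σℚ xs f ≡ 0ℚ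
  Σ-zero []       f≡0 = refl
  Σ-zero (x ∷ xs) f≡0 = trans (cong₂ _+_ (f≡0 x) (Σ-zero xs f≡0)) (ℚP.+-identityˡ 0ℚ)

  Σ-distrib-+ : ∀ xs (f g : A → ℚ) → Σℚ xs (λ x → f x + g x) ≡ Σℚ xs f + Σℚ xs g
  Σ-distrib-+ []       f g = refl
  Σ-distrib-+ (x ∷ xs) f g = trans (cong (f x + g x +_) (Σ-distrib-+ xs f g))
    (solve 4 (λ a b c d → (a :+ b) :+ (c :+ d) := (a :+ c) :+ (b :+ d)) refl
      (f x) (g x) (Σℚ xs f) (Σℚ xs g))

  *-distribˡ-Σ : ∀ c xs (f : A → ℚ) → c * Σℚ xs f ≡ Σℚ xs (λ x → c * f x)
  *-distribˡ-Σ c []       f = ℚP.*-zeroʳ c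
  *-distribˡ-Σ c (x ∷ xs) f =
    trans (ℚP.*-distribˡ-+ c (f x) _) (cong (c * f x +_) (*-distribˡ-Σ c xs f))

  *-distribʳ-Σ : ∀ c xs (f : A → ℚ) → Σℚ xs f * c ≡ Σℚ xs (λ x → f x * c)
  *-distribʳ-Σ c xs f = trans (ℚP.*-comm _ c)
    (trans (*-distribˡ-Σ c xs f) (Σ-cong xs (λ x → ℚP.*-comm c (f x))))

  neg-distrib-Σ : ∀ xs (f : A → ℚ) → - Σℚ xs f ≡ Σℚ xs (λ x → - f x)
  neg-distrib-Σ []       f = refl
  neg-distrib-Σ (x ∷ xs) f =
    trans (ℚP.neg-distrib-+ (f x) _) (cong (- f x +_) (neg-distrib-Σ xs f))

  Σ-factor : ∀ c xs (f g : A → ℚ) → Σℚ xs (λ x → f x * (c * g x)) ≡ c * Σℚ xs (λ x → f x * g x)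
  Σ-factor c xs f g = trans
    (Σ-cong xs (λ x → solve 3 (λ c a b → a :* (c :* b) := c :* (a :* b)) refl c (f x) (g x)))
    (sym (*-distribˡ-Σ c xs _))

  Σ-++ : ∀ xs ys (f : A → ℚ) → Σℚ (xs ++ ys) f ≡ Σℚ xs f + Σℚ ys f
  Σ-++ []       ys f = sym (ℚP.+-identityˡ _)
  Σ-++ (x ∷ xs) ys f = trans (cong (f x +_) (Σ-++ xs ys f)) (sym (ℚP.+-assoc (f x) _ _))

  Σ-map : ∀ {b} {B : Set b} (h : B → A) xs (f : A → ℚ) → Σℚ (map h xs) f ≡ Σℚ xs (f ∘ h)
  Σ-map h []       f = refl
  Σ-map h (x ∷ xs) f = cong (f (h x) +_) (Σ-map h xs f)

Σ-swap : ∀ {a b} {A : Set a} {B : Set b} xs ys (f : A → B → ℚ) →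
         Σℚ xs (λ x → Σℚ ys (f x)) ≡ Σℚ ys (λ y → Σℚ xs (λ x → f x y))
Σ-swap []       ys f = sym (Σ-zero ys (λ _ → refl))
Σ-swap (x ∷ xs) ys f =
  trans (cong (Σℚ ys (f x) +_) (Σ-swap xs ys f)) (sym (Σ-distrib-+ ys (f x) _))

Σ-upTo-suc : ∀ d (f : ℕ → ℚ) → Σℚ (upTo (suc d)) f ≡ f 0 + Σℚ (upTo d) (f ∘ suc)
Σ-upTo-suc d f = cong (f 0 +_)
  (trans (cong (λ xs → Σℚ xs f) (sym (map-applyUpTo (λ i → i) suc d))) (Σ-map suc (upTo d) f))

Σ-subsets-suc : ∀ n (f : Subset (suc n) → ℚ) →
  Σℚ (subsets (suc n)) f ≡ Σℚ (subsets n) (f ∘ (false ∷_)) + Σℚ (subsets n) (f ∘ (true ∷_))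
Σ-subsets-suc n f = trans (Σ-++ (map (false ∷_) (subsets n)) _ f)
  (cong₂ _+_ (Σ-map (false ∷_) (subsets n) f) (Σ-map (true ∷_) (subsets n) f))

^-distribˡ-+-* : ∀ x m k → x ^ (m ℕ.+ k) ≡ x ^ m * x ^ k
^-distribˡ-+-* x zero    k = sym (ℚP.*-identityˡ _)
^-distribˡ-+-* x (suc m) k = trans (cong (x *_) (^-distribˡ-+-* x m k)) (sym (ℚP.*-assoc x _ _))

^-distribʳ-* : ∀ x y k → (x * y) ^ k ≡ x ^ k * y ^ k
^-distribʳ-* x y zero    = refl
^-distribʳ-* x y (suc k) = trans (cong ((x * y) *_) (^-distribʳ-* x y k))
  (solve 4 (λ x y a b → (x :* y) :* (a :* b) := (x :* a) :* (y :* b)) refl x y (x ^ k) (y ^ k))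

1^k≡1 : ∀ k → 1ℚ ^ k ≡ 1ℚ
1^k≡1 zero    = refl
1^k≡1 (suc k) = cong (1ℚ *_) (1^k≡1 k)

^-cancel : ∀ {x y} → x * y ≡ 1ℚ → ∀ k → x ^ k * y ^ k ≡ 1ℚ
^-cancel {x} {y} xy≡1 k = trans (sym (^-distribʳ-* x y k)) (trans (cong (_^ k) xy≡1) (1^k≡1 k))

[-1]^k*[-1]^k≡1 : ∀ k → (- 1ℚ) ^ k * (- 1ℚ) ^ k ≡ 1ℚ
[-1]^k*[-1]^k≡1 = ^-cancel refl

-x^k≡[-1]^k*x^k : ∀ x k → (- x) ^ k ≡ (- 1ℚ) ^ k * x ^ k
-x^k≡[-1]^k*x^k x k = trans (cong (_^ k) (solve 1 (λ x → :- x := (:- con 1ℚ) :* x) refl x))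
  (^-distribʳ-* (- 1ℚ) x k)

^-absorb : ∀ {c c⁻¹} → c * c⁻¹ ≡ 1ℚ → ∀ x k m → c ^ (k ℕ.+ m) * (x * c⁻¹) ^ k ≡ c ^ m * x ^ k
^-absorb {c} {c⁻¹} cc⁻¹≡1 x k m = begin
  c ^ (k ℕ.+ m) * (x * c⁻¹) ^ k
    ≡⟨ cong₂ _*_ (^-distribˡ-+-* c k m) (^-distribʳ-* x c⁻¹ k) ⟩
  (c ^ k * c ^ m) * (x ^ k * c⁻¹ ^ k)
    ≡⟨ solve 4 (λ a b y z → (a :* b) :* (y :* z) := (b :* y) :* (a :* z)) refl
               (c ^ k) (c ^ m) (x ^ k) (c⁻¹ ^ k) ⟩
  (c ^ m * x ^ k) * (c ^ k * c⁻¹ ^ k)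
    ≡⟨ trans (cong ((c ^ m * x ^ k) *_) (^-cancel cc⁻¹≡1 k)) (ℚP.*-identityʳ _) ⟩
  c ^ m * x ^ k ∎
  where open ≡-Reasoning

x^k≡[-1]^k*[-x]^k : ∀ x k → x ^ k ≡ (- 1ℚ) ^ k * (- x) ^ k
x^k≡[-1]^k*[-x]^k x k = sym (begin
  (- 1ℚ) ^ k * (- x) ^ k           ≡⟨ cong ((- 1ℚ) ^ k *_) (-x^k≡[-1]^k*x^k x k) ⟩
  (- 1ℚ) ^ k * ((- 1ℚ) ^ k * x ^ k) ≡⟨ sym (ℚP.*-assoc ((- 1ℚ) ^ k) _ _) ⟩
  ((- 1ℚ) ^ k * (- 1ℚ) ^ k) * x ^ k ≡⟨ cong (_* x ^ k) ([-1]^k*[-1]^k≡1 k) ⟩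
  1ℚ * x ^ k                       ≡⟨ ℚP.*-identityˡ (x ^ k) ⟩
  x ^ k                            ∎)
  where open ≡-Reasoning

[-1]^[k+r]*[-x]^k : ∀ x k r → (- 1ℚ) ^ (k ℕ.+ r) * (- x) ^ k ≡ (- 1ℚ) ^ r * x ^ k
[-1]^[k+r]*[-x]^k x k r = begin
  (- 1ℚ) ^ (k ℕ.+ r) * (- x) ^ k
    ≡⟨ cong₂ _*_ (^-distribˡ-+-* (- 1ℚ) k r) (-x^k≡[-1]^k*x^k x k) ⟩
  ((- 1ℚ) ^ k * (- 1ℚ) ^ r) * ((- 1ℚ) ^ k * x ^ k)
    ≡⟨ solve 3 (λ a b y → (a :* b) :* (a :* y) := (a :* a) :* (b :* y)) refl ((- 1ℚ) ^ k) ((- 1ℚ) ^ r) (x ^ k) ⟩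
  ((- 1ℚ) ^ k * (- 1ℚ) ^ k) * ((- 1ℚ) ^ r * x ^ k)
    ≡⟨ trans (cong (_* ((- 1ℚ) ^ r * x ^ k)) ([-1]^k*[-1]^k≡1 k)) (ℚP.*-identityˡ _) ⟩
  (- 1ℚ) ^ r * x ^ k ∎
  where open ≡-Reasoning

d∸i≡1+[d∸1∸i] : ∀ {d i} → i ℕ.< d → d ∸ i ≡ suc (d ∸ 1 ∸ i)
d∸i≡1+[d∸1∸i] (ℕ.s≤s i≤d) = ℕP.+-∸-assoc 1 i≤d

[s+1+i]∸d+[d∸1∸i]≡s : ∀ {d i} s → i ℕ.< d → d ∸ i ℕ.≤ s →
                      (s ℕ.+ 1 ℕ.+ i) ∸ d ℕ.+ (d ∸ 1 ∸ i) ≡ s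
[s+1+i]∸d+[d∸1∸i]≡s {suc d} {i} s i<d@(ℕ.s≤s i≤d) d∸i≤s = begin
  (s ℕ.+ 1 ℕ.+ i) ∸ suc d ℕ.+ j
    ≡⟨ cong₂ (λ a b → a ∸ b ℕ.+ j) s+1+i≡1+i+s (cong suc (sym (ℕP.m+[n∸m]≡n i≤d))) ⟩
  (suc i ℕ.+ s) ∸ (suc i ℕ.+ j) ℕ.+ j
    ≡⟨ cong (ℕ._+ j) (ℕP.[m+n]∸[m+o]≡n∸o (suc i) s j) ⟩
  s ∸ j ℕ.+ j
    ≡⟨ ℕP.m∸n+n≡m (ℕP.<⇒≤ (subst (ℕ._≤ s) (d∸i≡1+[d∸1∸i] i<d) d∸i≤s)) ⟩
  s ∎
  where
  open ≡-Reasoning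
  j = d ∸ i
  s+1+i≡1+i+s : s ℕ.+ 1 ℕ.+ i ≡ suc i ℕ.+ s
  s+1+i≡1+i+s = trans (cong (ℕ._+ i) (ℕP.+-comm s 1)) (cong suc (ℕP.+-comm s i))

ℤ→ℚ≡mkℚ : ∀ z → ℤ→ℚ z ≡ mkℚ z 0 (Coprime.sym (Coprime.1-coprimeTo _))
ℤ→ℚ≡mkℚ z = ℚP.↥p/↧p≡p (mkℚ z 0 _)

ℤ→ℚ-+ : ∀ a b → ℤ→ℚ (a ℤ.+ b) ≡ ℤ→ℚ a + ℤ→ℚ b
ℤ→ℚ-+ a b rewrite ℤ→ℚ≡mkℚ a | ℤ→ℚ≡mkℚ b =
  cong (ℚ._/ 1) (sym (cong₂ ℤ._+_ (ℤP.*-identityʳ a) (ℤP.*-identityʳ b)))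

ℤ→ℚ-neg : ∀ a → ℤ→ℚ (ℤ.- a) ≡ - ℤ→ℚ a
ℤ→ℚ-neg a rewrite ℤ→ℚ≡mkℚ a | ℤ→ℚ≡mkℚ (ℤ.- a) = neg-mkℚ a
  where
  neg-mkℚ : ∀ a → mkℚ (ℤ.- a) 0 (Coprime.sym (Coprime.1-coprimeTo _))
                ≡ - mkℚ a 0 (Coprime.sym (Coprime.1-coprimeTo _))
  neg-mkℚ (ℤ.+ zero)  = refl
  neg-mkℚ (ℤ.+ suc n) = refl
  neg-mkℚ ℤ.-[1+ n ]  = refl

indicator : ∀ {p} {P : Set p} → Dec P → ℚ
indicator P? = if does P? then 1ℚ else 0ℚ

indicator-yes : ∀ {p} {P : Set p} (P? : Dec P) → P → indicator P? ≡ 1ℚ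
indicator-yes P? p = cong (if_then 1ℚ else 0ℚ) (dec-true P? p)

indicator-no : ∀ {p} {P : Set p} (P? : Dec P) → ¬ P → indicator P? ≡ 0ℚ
indicator-no P? ¬p = cong (if_then 1ℚ else 0ℚ) (dec-false P? ¬p)

weight : ∀ {n} → ℚ → ℚ → Subset n → ℚ
weight α β []          = 1ℚ
weight α β (true ∷ S)  = α * weight α β S
weight α β (false ∷ S) = β * weight α β S

weight-closed : ∀ {n} α β (S : Subset n) → weight α β S ≡ α ^ ∣ S ∣ * β ^ (n ∸ ∣ S ∣)
weight-closed α β []          = sym (ℚP.*-identityˡ 1ℚ)
weight-closed α β (true ∷ S)  =
  trans (cong (α *_) (weight-closed α β S)) (sym (ℚP.*-assoc α _ _))
weight-closed {suc n} α β (false ∷ S) rewrite ℕP.+-∸-assoc 1 (∣p∣≤n S) =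
  trans (cong (β *_) (weight-closed α β S))
    (solve 3 (λ b x y → b :* (x :* y) := x :* (b :* y)) refl β (α ^ ∣ S ∣) (β ^ (n ∸ ∣ S ∣)))

weight-1 : ∀ {n} α (S : Subset n) → weight α 1ℚ S ≡ α ^ ∣ S ∣
weight-1 α []          = refl
weight-1 α (true ∷ S)  = cong (α *_) (weight-1 α S)
weight-1 α (false ∷ S) = trans (ℚP.*-identityˡ _) (weight-1 α S)

Σ-weight : ∀ n α β → Σℚ (subsets n) (weight α β) ≡ (α + β) ^ n
Σ-weight zero    α β = ℚP.+-identityʳ 1ℚ
Σ-weight (suc n) α β = begin
  Σℚ (subsets (suc n)) (weight α β)
    ≡⟨ Σ-subsets-suc n (weight α β) ⟩
  Σℚ (subsets n) (λ S → β * weight α β S) + Σℚ (subsets n) (λ S → α * weight α β S)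
    ≡⟨ sym (cong₂ _+_ (*-distribˡ-Σ β (subsets n) _) (*-distribˡ-Σ α (subsets n) _)) ⟩
  β * Σℚ (subsets n) (weight α β) + α * Σℚ (subsets n) (weight α β)
    ≡⟨ cong (λ s → β * s + α * s) (Σ-weight n α β) ⟩
  β * (α + β) ^ n + α * (α + β) ^ n
    ≡⟨ solve 3 (λ a b s → b :* s :+ a :* s := (a :+ b) :* s) refl α β ((α + β) ^ n) ⟩
  (α + β) ^ suc n ∎
  where open ≡-Reasoning

Σ-⊇-weight : ∀ {n} α β (T : Subset n) →
  Σℚ (subsets n) (λ U → indicator (T ⊆? U) * weight α β U) ≡ weight α (α + β) T
Σ-⊇-weight α β [] = trans (ℚP.+-identityʳ _) (ℚP.*-identityˡ 1ℚ)
Σ-⊇-weight {suc n} α β (false ∷ T) = begin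
  Σℚ (subsets (suc n)) (λ U → indicator (false ∷ T ⊆? U) * weight α β U)
    ≡⟨ Σ-subsets-suc n (λ U → indicator (false ∷ T ⊆? U) * weight α β U) ⟩
  Σℚ (subsets n) (λ U → T⊆ U * (β * weight α β U)) + Σℚ (subsets n) (λ U → T⊆ U * (α * weight α β U))
    ≡⟨ cong₂ _+_ (Σ-factor β (subsets n) T⊆ (weight α β)) (Σ-factor α (subsets n) T⊆ (weight α β)) ⟩
  β * Σℚ (subsets n) (λ U → T⊆ U * weight α β U) + α * Σℚ (subsets n) (λ U → T⊆ U * weight α β U)
    ≡⟨ cong (λ s → β * s + α * s) (Σ-⊇-weight α β T) ⟩
  β * weight α (α + β) T + α * weight α (α + β) T
    ≡⟨ solve 3 (λ a b s → b :* s :+ a :* s := (a :+ b) :* s) refl α β (weight α (α + β) T) ⟩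
  (α + β) * weight α (α + β) T ∎
  where
  open ≡-Reasoning
  T⊆ : Subset n → ℚ
  T⊆ U = indicator (T ⊆? U)
Σ-⊇-weight {suc n} α β (true ∷ T) = begin
  Σℚ (subsets (suc n)) (λ U → indicator (true ∷ T ⊆? U) * weight α β U)
    ≡⟨ Σ-subsets-suc n (λ U → indicator (true ∷ T ⊆? U) * weight α β U) ⟩
  Σℚ (subsets n) (λ U → 0ℚ * (β * weight α β U)) + Σℚ (subsets n) (λ U → T⊆ U * (α * weight α β U))
    ≡⟨ cong₂ _+_ (Σ-zero (subsets n) (λ U → ℚP.*-zeroˡ (β * weight α β U)))
                 (Σ-factor α (subsets n) T⊆ (weight α β)) ⟩
  0ℚ + α * Σℚ (subsets n) (λ U → T⊆ U * weight α β U)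
    ≡⟨ trans (ℚP.+-identityˡ _) (cong (α *_) (Σ-⊇-weight α β T)) ⟩
  α * weight α (α + β) T ∎
  where
  open ≡-Reasoning
  T⊆ : Subset n → ℚ
  T⊆ U = indicator (T ⊆? U)

Σ-⊆-split : ∀ {n} (T : Subset n) (f : Subset n → ℚ) →
  Σℚ (subsets n) (λ U → indicator (U ⊆? T) * f U)
    ≡ f T + Σℚ (subsets n) (λ U → indicator (U ⊂? T) * f U)
Σ-⊆-split [] f = solve 1 (λ x → con 1ℚ :* x :+ con 0ℚ := x :+ (con 0ℚ :* x :+ con 0ℚ)) refl (f [])
Σ-⊆-split {suc n} (false ∷ T) f = begin
  Σℚ (subsets (suc n)) (λ U → indicator (U ⊆? false ∷ T) * f U)
    ≡⟨ Σ-subsets-suc n (λ U → indicator (U ⊆? false ∷ T) * f U) ⟩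
  Σℚ (subsets n) (λ U → indicator (U ⊆? T) * f (false ∷ U)) + Z
    ≡⟨ cong (_+ Z) (Σ-⊆-split T (f ∘ (false ∷_))) ⟩
  (f (false ∷ T) + Sf) + Z
    ≡⟨ ℚP.+-assoc (f (false ∷ T)) Sf Z ⟩
  f (false ∷ T) + (Sf + Z)
    ≡⟨ cong (f (false ∷ T) +_) (sym (Σ-subsets-suc n (λ U → indicator (U ⊂? false ∷ T) * f U))) ⟩
  f (false ∷ T) + Σℚ (subsets (suc n)) (λ U → indicator (U ⊂? false ∷ T) * f U) ∎
  where
  open ≡-Reasoning
  Sf = Σℚ (subsets n) (λ U → indicator (U ⊂? T) * f (false ∷ U))
  Z  = Σℚ (subsets n) (λ U → 0ℚ * f (true ∷ U))
Σ-⊆-split {suc n} (true ∷ T) f = begin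
  Σℚ (subsets (suc n)) (λ U → indicator (U ⊆? true ∷ T) * f U)
    ≡⟨ Σ-subsets-suc n (λ U → indicator (U ⊆? true ∷ T) * f U) ⟩
  Sf + Σℚ (subsets n) (λ U → indicator (U ⊆? T) * f (true ∷ U))
    ≡⟨ cong (Sf +_) (Σ-⊆-split T (f ∘ (true ∷_))) ⟩
  Sf + (f (true ∷ T) + St)
    ≡⟨ solve 3 (λ a b c → a :+ (b :+ c) := b :+ (a :+ c)) refl Sf (f (true ∷ T)) St ⟩
  f (true ∷ T) + (Sf + St)
    ≡⟨ cong (f (true ∷ T) +_) (sym (Σ-subsets-suc n (λ U → indicator (U ⊂? true ∷ T) * f U))) ⟩
  f (true ∷ T) + Σℚ (subsets (suc n)) (λ U → indicator (U ⊂? true ∷ T) * f U) ∎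
  where
  open ≡-Reasoning
  Sf = Σℚ (subsets n) (λ U → indicator (U ⊆? T) * f (false ∷ U))
  St = Σℚ (subsets n) (λ U → indicator (U ⊂? T) * f (true ∷ U))

module Möbius {n : ℕ} (M : Matroid n) (i : ℕ) where

  inS? : (S : Subset n) → Dec (inS M i S)
  inS? S = rk M ∸ i ≤? ρ M S

  -- lowerSum is solved by unification to the anonymous where-bound sumLower of μ-fuel;
  -- abstracting subsets n, ℤ.-_ and ℤ.1ℤ ℤ.+_ turns that unification problem into a pattern.
  mutual
    lowerSum : ℕ → (S : Subset n) → inS M i S → List (Subset n) → ℤ
    lowerSum k S S∈ = _

    μ-fuel-unfold : ∀ k S (S∈ : inS M i S) →
                    μ-fuel M i (suc k) S ≡ ℤ.- (ℤ.1ℤ ℤ.+ lowerSum k S S∈ (subsets n))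
    μ-fuel-unfold k S S∈ with inS? S
    ... | no S∉ = ⊥-elim (S∉ S∈)
    ... | yes S∈′ with ℕP.≤-irrelevant S∈′ S∈ | subsets n | ℤ.-_ | ℤ._+_ ℤ.1ℤ
    ...   | refl | Ts | neg | 1+ = refl

  μ-fuel-irrelevant : ∀ {k k′} T → ∣ T ∣ ℕ.< k → ∣ T ∣ ℕ.< k′ → μ-fuel M i k T ≡ μ-fuel M i k′ T
  μ-fuel-irrelevant {suc k} {suc k′} T |T|<k |T|<k′ with inS? T
  ... | no _   = refl
  ... | yes T∈ = cong (λ z → ℤ.- (ℤ.1ℤ ℤ.+ z)) (lowerSum-irrelevant (subsets n))
    where
    lowerSum-irrelevant : ∀ Us → lowerSum k T T∈ Us ≡ lowerSum k′ T T∈ Us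
    lowerSum-irrelevant []       = refl
    lowerSum-irrelevant (U ∷ Us) with U ⊂? T | inS? U
    ... | yes U⊂T | yes _ = cong₂ ℤ._+_
            (μ-fuel-irrelevant U (ℕP.<-≤-trans (p⊂q⇒∣p∣<∣q∣ U⊂T) (ℕP.≤-pred |T|<k))
                                 (ℕP.<-≤-trans (p⊂q⇒∣p∣<∣q∣ U⊂T) (ℕP.≤-pred |T|<k′)))
            (lowerSum-irrelevant Us)
    ... | yes _ | no _ = lowerSum-irrelevant Us
    ... | no _  | _    = lowerSum-irrelevant Us

  μ-outside : ∀ {S} → ¬ inS M i S → μ M i S ≡ ℤ.0ℤ
  μ-outside {S} S∉ with inS? S
  ... | yes S∈ = ⊥-elim (S∉ S∈)
  ... | no _   = refl

  μℚ : Subset n → ℚ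
  μℚ S = ℤ→ℚ (μ M i S)

  μℚ-outside : ∀ {S} → ¬ inS M i S → μℚ S ≡ 0ℚ
  μℚ-outside S∉ = cong ℤ→ℚ (μ-outside S∉)

  -- Stated for an arbitrary g (in practice μℚ) so that the with below cannot abstract inS? U inside μ.
  lowerSum-Σ : ∀ {T} (T∈ : inS M i T) (g : Subset n → ℚ) →
    (∀ {U} → U ⊂ T → inS M i U → ℤ→ℚ (μ-fuel M i n U) ≡ g U) →
    (∀ {U} → ¬ inS M i U → g U ≡ 0ℚ) →
    ∀ Us → ℤ→ℚ (lowerSum n T T∈ Us) ≡ Σℚ Us (λ U → indicator (U ⊂? T) * g U)
  lowerSum-Σ T∈ g μ≡g g≡0 [] = refl
  lowerSum-Σ {T} T∈ g μ≡g g≡0 (U ∷ Us) with U ⊂? T | inS? U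
  ... | yes U⊂T | yes U∈ = trans (ℤ→ℚ-+ (μ-fuel M i n U) _)
    (cong₂ _+_ (trans (μ≡g U⊂T U∈) (sym (ℚP.*-identityˡ (g U)))) (lowerSum-Σ T∈ g μ≡g g≡0 Us))
  ... | yes _ | no U∉ = trans (lowerSum-Σ T∈ g μ≡g g≡0 Us)
    (sym (x≡0⇒x+y≡y _ (trans (cong (1ℚ *_) (g≡0 U∉)) (ℚP.*-zeroʳ 1ℚ))))
  ... | no _  | _     = trans (lowerSum-Σ T∈ g μ≡g g≡0 Us) (sym (x≡0⇒x+y≡y _ (ℚP.*-zeroˡ (g U))))

  Σ-⊆-μℚ : ∀ T → Σℚ (subsets n) (λ U → indicator (U ⊆? T) * μℚ U) ≡ - indicator (inS? T)
  Σ-⊆-μℚ T with inS? T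
  ... | yes T∈ = begin
    Σℚ (subsets n) (λ U → indicator (U ⊆? T) * μℚ U)
      ≡⟨ Σ-⊆-split T μℚ ⟩
    μℚ T + Σℚ (subsets n) (λ U → indicator (U ⊂? T) * μℚ U)
      ≡⟨ cong (μℚ T +_) (sym (lowerSum-Σ T∈ μℚ μ≡μℚ μℚ-outside (subsets n))) ⟩
    ℤ→ℚ (μ-fuel M i (suc n) T) + ℤ→ℚ L
      ≡⟨ cong (λ m → ℤ→ℚ m + ℤ→ℚ L) (μ-fuel-unfold n T T∈) ⟩
    ℤ→ℚ (ℤ.- (ℤ.1ℤ ℤ.+ L)) + ℤ→ℚ L
      ≡⟨ cong (_+ ℤ→ℚ L) (trans (ℤ→ℚ-neg (ℤ.1ℤ ℤ.+ L)) (cong -_ (ℤ→ℚ-+ ℤ.1ℤ L))) ⟩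
    - (1ℚ + ℤ→ℚ L) + ℤ→ℚ L
      ≡⟨ solve 1 (λ x → :- (con 1ℚ :+ x) :+ x := :- con 1ℚ) refl (ℤ→ℚ L) ⟩
    - 1ℚ
      ≡⟨ cong -_ (sym (indicator-yes (inS? T) T∈)) ⟩
    - indicator (inS? T) ∎
    where
    open ≡-Reasoning
    L = lowerSum n T T∈ (subsets n)
    μ≡μℚ : ∀ {U} → U ⊂ T → inS M i U → ℤ→ℚ (μ-fuel M i n U) ≡ μℚ U
    μ≡μℚ {U} U⊂T _ = cong ℤ→ℚ (μ-fuel-irrelevant U |U|<n (ℕP.m<n⇒m<1+n |U|<n))
      where |U|<n = ℕP.<-≤-trans (p⊂q⇒∣p∣<∣q∣ U⊂T) (∣p∣≤n T)
  ... | no T∉ = trans (Σ-zero (subsets n) below-T-vanishes)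
    (sym (cong -_ (indicator-no (inS? T) T∉)))
    where
    below-T-vanishes : ∀ U → indicator (U ⊆? T) * μℚ U ≡ 0ℚ
    below-T-vanishes U with U ⊆? T
    ... | yes U⊆T = trans (ℚP.*-identityˡ (μℚ U))
                          (μℚ-outside (λ U∈ → T∉ (ℕP.≤-trans U∈ (ρ-mono M U⊆T))))
    ... | no _    = ℚP.*-zeroˡ (μℚ U)

  Σ-μℚ-pow≡-Σ-weight : ∀ α β → α + β ≡ 1ℚ →
    Σℚ (subsets n) (λ S → μℚ S * α ^ ∣ S ∣)
      ≡ - Σℚ (subsets n) (λ T → indicator (inS? T) * weight α β T)
  Σ-μℚ-pow≡-Σ-weight α β α+β≡1 = begin
    Σℚ (subsets n) (λ S → μℚ S * α ^ ∣ S ∣)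
      ≡⟨ Σ-cong (subsets n) (λ S → cong (μℚ S *_) (pow≡Σ-⊇-weight S)) ⟩
    Σℚ (subsets n) (λ S → μℚ S * Σℚ (subsets n) (λ T → indicator (S ⊆? T) * w T))
      ≡⟨ Σ-cong (subsets n) (λ S → *-distribˡ-Σ (μℚ S) (subsets n) (λ T → indicator (S ⊆? T) * w T)) ⟩
    Σℚ (subsets n) (λ S → Σℚ (subsets n) (term S))
      ≡⟨ Σ-swap (subsets n) (subsets n) term ⟩
    Σℚ (subsets n) (λ T → Σℚ (subsets n) (λ S → term S T))
      ≡⟨ Σ-cong (subsets n) inner ⟩
    Σℚ (subsets n) (λ T → - (indicator (inS? T) * w T))
      ≡⟨ sym (neg-distrib-Σ (subsets n) (λ T → indicator (inS? T) * w T)) ⟩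
    - Σℚ (subsets n) (λ T → indicator (inS? T) * w T) ∎
    where
    open ≡-Reasoning
    w = weight α β
    term : Subset n → Subset n → ℚ
    term S T = μℚ S * (indicator (S ⊆? T) * w T)
    pow≡Σ-⊇-weight : ∀ S → α ^ ∣ S ∣ ≡ Σℚ (subsets n) (λ T → indicator (S ⊆? T) * w T)
    pow≡Σ-⊇-weight S =
      sym (trans (Σ-⊇-weight α β S) (trans (cong (λ γ → weight α γ S) α+β≡1) (weight-1 α S)))
    inner : ∀ T → Σℚ (subsets n) (λ S → term S T) ≡ - (indicator (inS? T) * w T)
    inner T = begin
      Σℚ (subsets n) (λ S → term S T)
        ≡⟨ Σ-cong (subsets n) (λ S → solve 3 (λ m s x → m :* (s :* x) := (s :* m) :* x) refl
                                              (μℚ S) (indicator (S ⊆? T)) (w T)) ⟩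
      Σℚ (subsets n) (λ S → (indicator (S ⊆? T) * μℚ S) * w T)
        ≡⟨ sym (*-distribʳ-Σ (w T) (subsets n) (λ S → indicator (S ⊆? T) * μℚ S)) ⟩
      Σℚ (subsets n) (λ S → indicator (S ⊆? T) * μℚ S) * w T
        ≡⟨ cong (_* w T) (Σ-⊆-μℚ T) ⟩
      - indicator (inS? T) * w T
        ≡⟨ sym (ℚP.neg-distribˡ-* (indicator (inS? T)) (w T)) ⟩
      - (indicator (inS? T) * w T) ∎

  -- W-term is the where-bound summand term of W, named by the same unification trick.
  mutual
    W-term : ℚ → Subset n → ℚ
    W-term p = _

    W-unfold : ∀ p → W M i p ≡ Σℚ (subsets n) (W-term p)
    W-unfold p with subsets n | _+_
    ... | Ss | plus = refl

  W-term-inside : ∀ p {S} → inS M i S →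
    W-term p S ≡ ℤ→ℚ (μ M i S) * (- p) ^ ((∣ S ∣ ℕ.+ 1 ℕ.+ i) ∸ rk M)
  W-term-inside p {S} S∈ = W-term-inside′ (μ M i) (λ _ → refl)
    where
    -- μ is hidden behind a variable so that the with below does not abstract inS? S inside it.
    W-term-inside′ : (m : Subset n → ℤ) → (∀ U → μ M i U ≡ m U) →
      W-term p S ≡ ℤ→ℚ (m S) * (- p) ^ ((∣ S ∣ ℕ.+ 1 ℕ.+ i) ∸ rk M)
    W-term-inside′ m μ≡m with inS? S
    ... | yes _ = cong (λ z → ℤ→ℚ z * (- p) ^ ((∣ S ∣ ℕ.+ 1 ℕ.+ i) ∸ rk M)) (μ≡m S)
    ... | no S∉ = ⊥-elim (S∉ S∈)

  W-term-outside : ∀ p {S} → ¬ inS M i S → W-term p S ≡ 0ℚ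
  W-term-outside p {S} S∉ with inS? S
  ... | yes S∈ = ⊥-elim (S∉ S∈)
  ... | no _   = refl

  W-term*p^[d∸1∸i] : i ℕ.< rk M → ∀ p S →
    W-term p S * p ^ (rk M ∸ 1 ∸ i) ≡ (- 1ℚ) ^ (rk M ∸ 1 ∸ i) * (μℚ S * (- p) ^ ∣ S ∣)
  W-term*p^[d∸1∸i] i<d p S = by-cases (inS? S)
    where
    open ≡-Reasoning
    j = rk M ∸ 1 ∸ i
    e = (∣ S ∣ ℕ.+ 1 ℕ.+ i) ∸ rk M
    by-cases : Dec (inS M i S) → W-term p S * p ^ j ≡ (- 1ℚ) ^ j * (μℚ S * (- p) ^ ∣ S ∣)
    by-cases (no S∉) = begin
      W-term p S * p ^ j
        ≡⟨ cong (_* p ^ j) (W-term-outside p S∉) ⟩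
      0ℚ * p ^ j
        ≡⟨ solve 3 (λ a b c → con 0ℚ :* a := b :* (con 0ℚ :* c)) refl
                   (p ^ j) ((- 1ℚ) ^ j) ((- p) ^ ∣ S ∣) ⟩
      (- 1ℚ) ^ j * (0ℚ * (- p) ^ ∣ S ∣)
        ≡⟨ cong (λ x → (- 1ℚ) ^ j * (x * (- p) ^ ∣ S ∣)) (sym (μℚ-outside S∉)) ⟩
      (- 1ℚ) ^ j * (μℚ S * (- p) ^ ∣ S ∣) ∎
    by-cases (yes S∈) = begin
      W-term p S * p ^ j
        ≡⟨ cong₂ _*_ (W-term-inside p S∈) (x^k≡[-1]^k*[-x]^k p j) ⟩
      (μℚ S * (- p) ^ e) * ((- 1ℚ) ^ j * (- p) ^ j)
        ≡⟨ solve 4 (λ m x s y → (m :* x) :* (s :* y) := s :* (m :* (x :* y))) refl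
                   (μℚ S) ((- p) ^ e) ((- 1ℚ) ^ j) ((- p) ^ j) ⟩
      (- 1ℚ) ^ j * (μℚ S * ((- p) ^ e * (- p) ^ j))
        ≡⟨ cong (λ x → (- 1ℚ) ^ j * (μℚ S * x)) (sym (^-distribˡ-+-* (- p) e j)) ⟩
      (- 1ℚ) ^ j * (μℚ S * (- p) ^ (e ℕ.+ j))
        ≡⟨ cong (λ k → (- 1ℚ) ^ j * (μℚ S * (- p) ^ k))
                ([s+1+i]∸d+[d∸1∸i]≡s ∣ S ∣ i<d (ℕP.≤-trans S∈ (ρ-bounded M S))) ⟩
      (- 1ℚ) ^ j * (μℚ S * (- p) ^ ∣ S ∣) ∎

  W*p^[d∸1∸i] : i ℕ.< rk M → ∀ p → W M i p * p ^ (rk M ∸ 1 ∸ i)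
    ≡ (- 1ℚ) ^ (rk M ∸ i) * Σℚ (subsets n) (λ S → indicator (inS? S) * weight (- p) (1ℚ + p) S)
  W*p^[d∸1∸i] i<d p = begin
    W M i p * p ^ j
      ≡⟨ cong (_* p ^ j) (W-unfold p) ⟩
    Σℚ (subsets n) (W-term p) * p ^ j
      ≡⟨ *-distribʳ-Σ (p ^ j) (subsets n) (W-term p) ⟩
    Σℚ (subsets n) (λ S → W-term p S * p ^ j)
      ≡⟨ Σ-cong (subsets n) (W-term*p^[d∸1∸i] i<d p) ⟩
    Σℚ (subsets n) (λ S → (- 1ℚ) ^ j * (μℚ S * (- p) ^ ∣ S ∣))
      ≡⟨ sym (*-distribˡ-Σ ((- 1ℚ) ^ j) (subsets n) (λ S → μℚ S * (- p) ^ ∣ S ∣)) ⟩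
    (- 1ℚ) ^ j * Σℚ (subsets n) (λ S → μℚ S * (- p) ^ ∣ S ∣)
      ≡⟨ cong ((- 1ℚ) ^ j *_) (Σ-μℚ-pow≡-Σ-weight (- p) (1ℚ + p) (-p+[1+p]≡1 p)) ⟩
    (- 1ℚ) ^ j * (- G)
      ≡⟨ solve 2 (λ s g → s :* (:- g) := (:- con 1ℚ :* s) :* g) refl ((- 1ℚ) ^ j) G ⟩
    (- 1ℚ) ^ suc j * G
      ≡⟨ cong (λ k → (- 1ℚ) ^ k * G) (sym (d∸i≡1+[d∸1∸i] i<d)) ⟩
    (- 1ℚ) ^ (rk M ∸ i) * G ∎
    where
    open ≡-Reasoning
    j = rk M ∸ 1 ∸ i
    G = Σℚ (subsets n) (λ S → indicator (inS? S) * weight (- p) (1ℚ + p) S)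

module _ {n} (M : Matroid n) where

  ρ≤rk : ∀ S → ρ M S ℕ.≤ rk M
  ρ≤rk S = ρ-mono M ⊆⊤

  ρ-subadditive : ∀ S T → ρ M (S ∪ T) ℕ.≤ ρ M S ℕ.+ ρ M T
  ρ-subadditive S T = ℕP.≤-trans (ℕP.m≤m+n _ _) (ρ-submod M S T)

  rk∸ρ≤∣∁∣ : ∀ S → rk M ∸ ρ M S ℕ.≤ n ∸ ∣ S ∣
  rk∸ρ≤∣∁∣ S = ℕP.m≤n+o⇒m∸n≤o (rk M) (ρ M S) (begin
    rk M                     ≡⟨ cong (ρ M) (sym (p∪∁p≡⊤ S)) ⟩
    ρ M (S ∪ ∁ S)            ≤⟨ ρ-subadditive S (∁ S) ⟩
    ρ M S ℕ.+ ρ M (∁ S)      ≤⟨ ℕP.+-monoʳ-≤ (ρ M S) (ρ-bounded M (∁ S)) ⟩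
    ρ M S ℕ.+ ∣ ∁ S ∣         ≡⟨ cong (ρ M S ℕ.+_) (∣∁p∣≡n∸∣p∣ S) ⟩
    ρ M S ℕ.+ (n ∸ ∣ S ∣)     ∎)
    where open ℕP.≤-Reasoning

  Y-summand : ∀ {q a b} t → (1ℚ - q) * a ≡ 1ℚ → q * b ≡ 1ℚ → ∀ S →
    ((1ℚ - q) ^ rk M * q ^ σ M ⊤) * (((q * t) * a) ^ (rk M ∸ ρ M S) * ((1ℚ - q) * b) ^ σ M S)
      ≡ t ^ (rk M ∸ ρ M S) * weight (1ℚ - q) q S
  Y-summand {q} {a} {b} t Aa≡1 qb≡1 S = begin
    (A ^ rk M * q ^ σ M ⊤) * (((q * t) * a) ^ k * (A * b) ^ s)
      ≡⟨ cong₂ (λ x y → (A ^ x * q ^ y) * (((q * t) * a) ^ k * (A * b) ^ s)) rk≡k+r σ⊤≡s+e ⟩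
    (A ^ (k ℕ.+ r) * q ^ (s ℕ.+ e)) * (((q * t) * a) ^ k * (A * b) ^ s)
      ≡⟨ solve 4 (λ x y z w → (x :* y) :* (z :* w) := (x :* z) :* (y :* w)) refl
                 (A ^ (k ℕ.+ r)) (q ^ (s ℕ.+ e)) (((q * t) * a) ^ k) ((A * b) ^ s) ⟩
    (A ^ (k ℕ.+ r) * ((q * t) * a) ^ k) * (q ^ (s ℕ.+ e) * (A * b) ^ s)
      ≡⟨ cong₂ _*_ (^-absorb Aa≡1 (q * t) k r) (^-absorb qb≡1 A s e) ⟩
    (A ^ r * (q * t) ^ k) * (q ^ e * A ^ s)
      ≡⟨ cong (λ x → (A ^ r * x) * (q ^ e * A ^ s)) (^-distribʳ-* q t k) ⟩
    (A ^ r * (q ^ k * t ^ k)) * (q ^ e * A ^ s)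
      ≡⟨ solve 5 (λ ar qk tk qe as → (ar :* (qk :* tk)) :* (qe :* as) := tk :* ((ar :* as) :* (qk :* qe))) refl
                 (A ^ r) (q ^ k) (t ^ k) (q ^ e) (A ^ s) ⟩
    t ^ k * ((A ^ r * A ^ s) * (q ^ k * q ^ e))
      ≡⟨ sym (cong₂ (λ x y → t ^ k * (x * y)) (^-distribˡ-+-* A r s) (^-distribˡ-+-* q k e)) ⟩
    t ^ k * (A ^ (r ℕ.+ s) * q ^ (k ℕ.+ e))
      ≡⟨ cong₂ (λ x y → t ^ k * (A ^ x * q ^ y)) (sym ∣S∣≡r+s) (sym c≡k+e) ⟩
    t ^ k * (A ^ ∣ S ∣ * q ^ (n ∸ ∣ S ∣))
      ≡⟨ cong (t ^ k *_) (sym (weight-closed A q S)) ⟩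
    t ^ k * weight A q S ∎
    where
    open ≡-Reasoning
    A = 1ℚ - q
    r = ρ M S
    s = σ M S
    k = rk M ∸ r
    e = (n ∸ ∣ S ∣) ∸ k
    rk≡k+r : rk M ≡ k ℕ.+ r
    rk≡k+r = sym (ℕP.m∸n+n≡m (ρ≤rk S))
    ∣S∣≡r+s : ∣ S ∣ ≡ r ℕ.+ s
    ∣S∣≡r+s = sym (ℕP.m+[n∸m]≡n (ρ-bounded M S))
    c≡k+e : n ∸ ∣ S ∣ ≡ k ℕ.+ e
    c≡k+e = sym (ℕP.m+[n∸m]≡n (rk∸ρ≤∣∁∣ S))
    σ⊤≡s+e : σ M ⊤ ≡ s ℕ.+ e
    σ⊤≡s+e = begin
      ∣ ⊤ {n} ∣ ∸ rk M                     ≡⟨ cong₂ _∸_ (∣⊤∣≡n n) rk≡k+r ⟩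
      n ∸ (k ℕ.+ r)                       ≡⟨ cong (_∸ (k ℕ.+ r)) (sym (ℕP.m+[n∸m]≡n (∣p∣≤n S))) ⟩
      (∣ S ∣ ℕ.+ (n ∸ ∣ S ∣)) ∸ (k ℕ.+ r)   ≡⟨ cong₂ (λ x y → (x ℕ.+ y) ∸ (k ℕ.+ r)) ∣S∣≡r+s c≡k+e ⟩
      ((r ℕ.+ s) ℕ.+ (k ℕ.+ e)) ∸ (k ℕ.+ r) ≡⟨ cong (_∸ (k ℕ.+ r)) (+-interchange r s k e) ⟩
      ((r ℕ.+ k) ℕ.+ (s ℕ.+ e)) ∸ (k ℕ.+ r) ≡⟨ cong (λ x → (x ℕ.+ (s ℕ.+ e)) ∸ (k ℕ.+ r)) (ℕP.+-comm r k) ⟩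
      ((k ℕ.+ r) ℕ.+ (s ℕ.+ e)) ∸ (k ℕ.+ r) ≡⟨ ℕP.m+n∸m≡n (k ℕ.+ r) (s ℕ.+ e) ⟩
      s ℕ.+ e                             ∎

  Y-expansion : ∀ q t (q≢0 : q ≢ 0ℚ) (1-q≢0 : 1ℚ - q ≢ 0ℚ) →
    Y M q t q≢0 1-q≢0 ≡ Σℚ (subsets n) (λ S → t ^ (rk M ∸ ρ M S) * weight (1ℚ - q) q S)
  Y-expansion q t q≢0 1-q≢0 = begin
    C * Σℚ (subsets n) (λ S → (X - 1ℚ) ^ (rk M ∸ ρ M S) * (b - 1ℚ) ^ σ M S)
      ≡⟨ *-distribˡ-Σ C (subsets n) (λ S → (X - 1ℚ) ^ (rk M ∸ ρ M S) * (b - 1ℚ) ^ σ M S) ⟩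
    Σℚ (subsets n) (λ S → C * ((X - 1ℚ) ^ (rk M ∸ ρ M S) * (b - 1ℚ) ^ σ M S))
      ≡⟨ Σ-cong (subsets n) (λ S → trans
           (cong₂ (λ x y → C * (x ^ (rk M ∸ ρ M S) * y ^ σ M S)) X-1≡qta b-1≡[1-q]b)
           (Y-summand t Aa≡1 qb≡1 S)) ⟩
    Σℚ (subsets n) (λ S → t ^ (rk M ∸ ρ M S) * weight (1ℚ - q) q S) ∎
    where
    open ≡-Reasoning
    instance
      _ = ≢-nonZero q≢0
      _ = ≢-nonZero 1-q≢0
    C = (1ℚ - q) ^ rk M * q ^ σ M ⊤
    a = 1/ (1ℚ - q)
    b = 1/ q
    X = (q * t + 1ℚ - q) ÷ (1ℚ - q)
    Aa≡1 : (1ℚ - q) * a ≡ 1ℚ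
    Aa≡1 = ℚP.*-inverseʳ (1ℚ - q)
    qb≡1 : q * b ≡ 1ℚ
    qb≡1 = ℚP.*-inverseʳ q
    X-1≡qta : X - 1ℚ ≡ (q * t) * a
    X-1≡qta = begin
      (q * t + 1ℚ - q) * a - 1ℚ
        ≡⟨ solve 3 (λ q t a → (q :* t :+ con 1ℚ :- q) :* a :- con 1ℚ
                                := (q :* t) :* a :+ ((con 1ℚ :- q) :* a :- con 1ℚ)) refl q t a ⟩
      (q * t) * a + ((1ℚ - q) * a - 1ℚ)
        ≡⟨ cong (λ x → (q * t) * a + (x - 1ℚ)) Aa≡1 ⟩
      (q * t) * a + (1ℚ - 1ℚ)
        ≡⟨ solve 1 (λ x → x :+ (con 1ℚ :- con 1ℚ) := x) refl ((q * t) * a) ⟩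
      (q * t) * a ∎
    b-1≡[1-q]b : b - 1ℚ ≡ (1ℚ - q) * b
    b-1≡[1-q]b = begin
      b - 1ℚ
        ≡⟨ solve 2 (λ q b → b :- con 1ℚ := (con 1ℚ :- q) :* b :+ (q :* b :- con 1ℚ)) refl q b ⟩
      (1ℚ - q) * b + (q * b - 1ℚ)   ≡⟨ cong (λ x → (1ℚ - q) * b + (x - 1ℚ)) qb≡1 ⟩
      (1ℚ - q) * b + (1ℚ - 1ℚ)      ≡⟨ solve 1 (λ x → x :+ (con 1ℚ :- con 1ℚ) := x) refl ((1ℚ - q) * b) ⟩
      (1ℚ - q) * b                  ∎

module _ (t : ℚ) where

  signedTerm : ℕ → ℕ → ℕ → ℚ
  signedTerm d r i = indicator (d ∸ i ≤? r) * ((- 1ℚ) ^ (d ∸ i) * t ^ i)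

  signedTail : ℕ → ℕ → ℚ
  signedTail d r = Σℚ (upTo d) (signedTerm d r)

  signedTail-suc : ∀ d r →
    signedTail (suc d) r ≡ indicator (suc d ≤? r) * ((- 1ℚ) ^ suc d * 1ℚ) + t * signedTail d r
  signedTail-suc d r = trans (Σ-upTo-suc d (signedTerm (suc d) r)) (cong (signedTerm (suc d) r 0 +_)
    (trans (Σ-cong (upTo d) (λ i → solve 4 (λ a s t x → a :* (s :* (t :* x)) := t :* (a :* (s :* x))) refl
                                             (indicator (d ∸ i ≤? r)) ((- 1ℚ) ^ (d ∸ i)) t (t ^ i)))
           (sym (*-distribˡ-Σ t (upTo d) (signedTerm d r)))))

  [1+t]*signedTail-≥ : ∀ d r → d ℕ.≤ r → (1ℚ + t) * signedTail d r ≡ (- 1ℚ) ^ d - t ^ d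
  [1+t]*signedTail-≥ zero    r _   = trans (ℚP.*-zeroʳ (1ℚ + t)) (sym (ℚP.+-inverseʳ 1ℚ))
  [1+t]*signedTail-≥ (suc d) r d<r = begin
    (1ℚ + t) * signedTail (suc d) r
      ≡⟨ cong ((1ℚ + t) *_) (signedTail-suc d r) ⟩
    (1ℚ + t) * (indicator (suc d ≤? r) * ((- 1ℚ) ^ suc d * 1ℚ) + t * signedTail d r)
      ≡⟨ cong (λ x → (1ℚ + t) * (x * ((- 1ℚ) ^ suc d * 1ℚ) + t * signedTail d r))
              (indicator-yes (suc d ≤? r) d<r) ⟩
    (1ℚ + t) * (1ℚ * ((- 1ℚ) ^ suc d * 1ℚ) + t * signedTail d r)
      ≡⟨ solve 3 (λ t s L → (con 1ℚ :+ t) :* (con 1ℚ :* ((:- con 1ℚ :* s) :* con 1ℚ) :+ t :* L)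
                             := (:- con 1ℚ :* s) :* (con 1ℚ :+ t) :+ t :* ((con 1ℚ :+ t) :* L))
                 refl t ((- 1ℚ) ^ d) (signedTail d r) ⟩
    (- 1ℚ) ^ suc d * (1ℚ + t) + t * ((1ℚ + t) * signedTail d r)
      ≡⟨ cong (λ x → (- 1ℚ) ^ suc d * (1ℚ + t) + t * x) ([1+t]*signedTail-≥ d r (ℕP.<⇒≤ d<r)) ⟩
    (- 1ℚ) ^ suc d * (1ℚ + t) + t * ((- 1ℚ) ^ d - t ^ d)
      ≡⟨ solve 3 (λ t s x → (:- con 1ℚ :* s) :* (con 1ℚ :+ t) :+ t :* (s :- x) := (:- con 1ℚ :* s) :- t :* x)
                 refl t ((- 1ℚ) ^ d) (t ^ d) ⟩
    (- 1ℚ) ^ suc d - t ^ suc d ∎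
    where open ≡-Reasoning

  [1+t]*signedTail-≤ : ∀ d r → r ℕ.≤ d → (1ℚ + t) * signedTail d r ≡ (- 1ℚ) ^ r * t ^ (d ∸ r) - t ^ d
  [1+t]*signedTail-≤ zero .zero ℕ.z≤n =
    solve 1 (λ t → (con 1ℚ :+ t) :* con 0ℚ := con 1ℚ :* con 1ℚ :- con 1ℚ) refl t
  [1+t]*signedTail-≤ (suc d) r r≤1+d with ℕP.m≤n⇒m<n∨m≡n r≤1+d
  ... | inj₂ refl = trans ([1+t]*signedTail-≥ (suc d) (suc d) ℕP.≤-refl)
    (cong (_- t ^ suc d) (sym (trans (cong (λ k → (- 1ℚ) ^ suc d * t ^ k) (ℕP.n∸n≡0 d))
                                     (ℚP.*-identityʳ ((- 1ℚ) ^ suc d)))))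
  ... | inj₁ (ℕ.s≤s r≤d) = begin
    (1ℚ + t) * signedTail (suc d) r
      ≡⟨ cong ((1ℚ + t) *_) (signedTail-suc d r) ⟩
    (1ℚ + t) * (indicator (suc d ≤? r) * ((- 1ℚ) ^ suc d * 1ℚ) + t * signedTail d r)
      ≡⟨ cong (λ x → (1ℚ + t) * (x * ((- 1ℚ) ^ suc d * 1ℚ) + t * signedTail d r))
              (indicator-no (suc d ≤? r) (ℕP.<⇒≱ (ℕ.s≤s r≤d))) ⟩
    (1ℚ + t) * (0ℚ * ((- 1ℚ) ^ suc d * 1ℚ) + t * signedTail d r)
      ≡⟨ solve 3 (λ t s L → (con 1ℚ :+ t) :* (con 0ℚ :* s :+ t :* L) := t :* ((con 1ℚ :+ t) :* L))
                 refl t ((- 1ℚ) ^ suc d * 1ℚ) (signedTail d r) ⟩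
    t * ((1ℚ + t) * signedTail d r)
      ≡⟨ cong (t *_) ([1+t]*signedTail-≤ d r r≤d) ⟩
    t * ((- 1ℚ) ^ r * t ^ (d ∸ r) - t ^ d)
      ≡⟨ solve 4 (λ t s x y → t :* (s :* x :- y) := s :* (t :* x) :- t :* y) refl
                 t ((- 1ℚ) ^ r) (t ^ (d ∸ r)) (t ^ d) ⟩
    (- 1ℚ) ^ r * t ^ suc (d ∸ r) - t ^ suc d
      ≡⟨ cong (λ k → (- 1ℚ) ^ r * t ^ k - t ^ suc d) (sym (ℕP.+-∸-assoc 1 r≤d)) ⟩
    (- 1ℚ) ^ r * t ^ (suc d ∸ r) - t ^ suc d ∎
    where open ≡-Reasoning

module _ {n} (M : Matroid n) (p t : ℚ) where

  private
    d = rk M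
    g : Subset n → ℚ
    g = weight (- p) (1ℚ + p)
    u : Subset n → ℚ
    u S = (- 1ℚ) ^ ρ M S * t ^ (d ∸ ρ M S)

  RHS≡Σ-signedTail : RHS M p t ≡ Σℚ (subsets n) (λ S → g S * signedTail t d (ρ M S))
  RHS≡Σ-signedTail = begin
    Σℚ (upTo d) (λ i → W M i p * p ^ (d ∸ 1 ∸ i) * t ^ i)
      ≡⟨ Σ-cong-∈ (upTo d) (λ {i} i∈ → cong (_* t ^ i) (Möbius.W*p^[d∸1∸i] M i (∈-upTo⁻ i∈) p)) ⟩
    Σℚ (upTo d) (λ i → ((- 1ℚ) ^ (d ∸ i) * Σℚ (subsets n) (λ S → [ i ]≤ρ S * g S)) * t ^ i)
      ≡⟨ Σ-cong (upTo d) spread ⟩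
    Σℚ (upTo d) (λ i → Σℚ (subsets n) (λ S → g S * c i S))
      ≡⟨ Σ-swap (upTo d) (subsets n) (λ i S → g S * c i S) ⟩
    Σℚ (subsets n) (λ S → Σℚ (upTo d) (λ i → g S * c i S))
      ≡⟨ Σ-cong (subsets n) (λ S → sym (*-distribˡ-Σ (g S) (upTo d) (signedTerm t d (ρ M S)))) ⟩
    Σℚ (subsets n) (λ S → g S * signedTail t d (ρ M S)) ∎
    where
    open ≡-Reasoning
    [_]≤ρ : ℕ → Subset n → ℚ
    [ i ]≤ρ S = indicator (d ∸ i ≤? ρ M S)
    c : ℕ → Subset n → ℚ
    c i S = signedTerm t d (ρ M S) i
    spread : ∀ i → ((- 1ℚ) ^ (d ∸ i) * Σℚ (subsets n) (λ S → [ i ]≤ρ S * g S)) * t ^ i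
                   ≡ Σℚ (subsets n) (λ S → g S * c i S)
    spread i = begin
      ((- 1ℚ) ^ (d ∸ i) * Σℚ (subsets n) (λ S → [ i ]≤ρ S * g S)) * t ^ i
        ≡⟨ cong (_* t ^ i) (*-distribˡ-Σ ((- 1ℚ) ^ (d ∸ i)) (subsets n) (λ S → [ i ]≤ρ S * g S)) ⟩
      Σℚ (subsets n) (λ S → (- 1ℚ) ^ (d ∸ i) * ([ i ]≤ρ S * g S)) * t ^ i
        ≡⟨ *-distribʳ-Σ (t ^ i) (subsets n) (λ S → (- 1ℚ) ^ (d ∸ i) * ([ i ]≤ρ S * g S)) ⟩
      Σℚ (subsets n) (λ S → ((- 1ℚ) ^ (d ∸ i) * ([ i ]≤ρ S * g S)) * t ^ i)
        ≡⟨ Σ-cong (subsets n) (λ S → solve 4 (λ s b x y → (s :* (b :* x)) :* y := x :* (b :* (s :* y)))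
                                             refl ((- 1ℚ) ^ (d ∸ i)) ([ i ]≤ρ S) (g S) (t ^ i)) ⟩
      Σℚ (subsets n) (λ S → g S * c i S) ∎

  Σg≡1 : Σℚ (subsets n) g ≡ 1ℚ
  Σg≡1 = trans (Σ-weight n (- p) (1ℚ + p)) (trans (cong (_^ n) (-p+[1+p]≡1 p)) (1^k≡1 n))

  [1+t]*RHS : (1ℚ + t) * RHS M p t ≡ Σℚ (subsets n) (λ S → u S * g S) - t ^ d
  [1+t]*RHS = begin
    (1ℚ + t) * RHS M p t
      ≡⟨ cong ((1ℚ + t) *_) RHS≡Σ-signedTail ⟩
    (1ℚ + t) * Σℚ (subsets n) (λ S → g S * signedTail t d (ρ M S))
      ≡⟨ *-distribˡ-Σ (1ℚ + t) (subsets n) (λ S → g S * signedTail t d (ρ M S)) ⟩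
    Σℚ (subsets n) (λ S → (1ℚ + t) * (g S * signedTail t d (ρ M S)))
      ≡⟨ Σ-cong (subsets n) telescope ⟩
    Σℚ (subsets n) (λ S → u S * g S + (- t ^ d) * g S)
      ≡⟨ Σ-distrib-+ (subsets n) (λ S → u S * g S) (λ S → (- t ^ d) * g S) ⟩
    U + Σℚ (subsets n) (λ S → (- t ^ d) * g S)
      ≡⟨ cong (U +_) (trans (sym (*-distribˡ-Σ (- t ^ d) (subsets n) g)) (cong ((- t ^ d) *_) Σg≡1)) ⟩
    U + (- t ^ d) * 1ℚ
      ≡⟨ solve 2 (λ a x → a :+ (:- x) :* con 1ℚ := a :- x) refl U (t ^ d) ⟩
    U - t ^ d ∎
    where
    open ≡-Reasoning
    U = Σℚ (subsets n) (λ S → u S * g S)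
    telescope : ∀ S → (1ℚ + t) * (g S * signedTail t d (ρ M S)) ≡ u S * g S + (- t ^ d) * g S
    telescope S = begin
      (1ℚ + t) * (g S * signedTail t d (ρ M S))
        ≡⟨ solve 3 (λ t x L → (con 1ℚ :+ t) :* (x :* L) := x :* ((con 1ℚ :+ t) :* L))
                   refl t (g S) (signedTail t d (ρ M S)) ⟩
      g S * ((1ℚ + t) * signedTail t d (ρ M S))
        ≡⟨ cong (g S *_) ([1+t]*signedTail-≤ t d (ρ M S) (ρ≤rk M S)) ⟩
      g S * (u S - t ^ d)
        ≡⟨ solve 3 (λ x v y → x :* (v :- y) := v :* x :+ (:- y) :* x) refl (g S) (u S) (t ^ d) ⟩
      u S * g S + (- t ^ d) * g S ∎

  [-1]^d*Y : ∀ h₁ h₂ → (- 1ℚ) ^ d * Y M (1ℚ + p) (- t) h₁ h₂ ≡ Σℚ (subsets n) (λ S → u S * g S)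
  [-1]^d*Y h₁ h₂ = begin
    (- 1ℚ) ^ d * Y M (1ℚ + p) (- t) h₁ h₂
      ≡⟨ cong ((- 1ℚ) ^ d *_) (Y-expansion M (1ℚ + p) (- t) h₁ h₂) ⟩
    (- 1ℚ) ^ d * Σℚ (subsets n) (λ S → (- t) ^ (d ∸ ρ M S) * g′ S)
      ≡⟨ *-distribˡ-Σ ((- 1ℚ) ^ d) (subsets n) (λ S → (- t) ^ (d ∸ ρ M S) * g′ S) ⟩
    Σℚ (subsets n) (λ S → (- 1ℚ) ^ d * ((- t) ^ (d ∸ ρ M S) * g′ S))
      ≡⟨ Σ-cong (subsets n) signs ⟩
    Σℚ (subsets n) (λ S → u S * g S) ∎
    where
    open ≡-Reasoning
    g′ = weight (1ℚ - (1ℚ + p)) (1ℚ + p)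
    signs : ∀ S → (- 1ℚ) ^ d * ((- t) ^ (d ∸ ρ M S) * g′ S) ≡ u S * g S
    signs S = begin
      (- 1ℚ) ^ d * ((- t) ^ k * g′ S)
        ≡⟨ cong₂ (λ e α → (- 1ℚ) ^ e * ((- t) ^ k * weight α (1ℚ + p) S))
                 (sym (ℕP.m∸n+n≡m (ρ≤rk M S))) (solve 1 (λ p → con 1ℚ :- (con 1ℚ :+ p) := :- p) refl p) ⟩
      (- 1ℚ) ^ (k ℕ.+ ρ M S) * ((- t) ^ k * g S)
        ≡⟨ sym (ℚP.*-assoc ((- 1ℚ) ^ (k ℕ.+ ρ M S)) ((- t) ^ k) (g S)) ⟩
      ((- 1ℚ) ^ (k ℕ.+ ρ M S) * (- t) ^ k) * g S
        ≡⟨ cong (_* g S) ([-1]^[k+r]*[-x]^k t k (ρ M S)) ⟩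
      u S * g S ∎
      where k = d ∸ ρ M S

  [-1]^d*Y-t^d≡[1+t]*RHS : ∀ h₁ h₂ →
    (- 1ℚ) ^ d * Y M (1ℚ + p) (- t) h₁ h₂ - t ^ d ≡ (1ℚ + t) * RHS M p t
  [-1]^d*Y-t^d≡[1+t]*RHS h₁ h₂ = trans (cong (_- t ^ d) ([-1]^d*Y h₁ h₂)) (sym [1+t]*RHS)

theorem2p6 : ∀ (n : ℕ) (M : Matroid n) (p t : ℚ)
               (h₁ : (1ℚ + p) ≢ 0ℚ) (h₂ : (1ℚ - (1ℚ + p)) ≢ 0ℚ)
               (h₃ : (1ℚ + t) ≢ 0ℚ) →
               Yhat M p t h₁ h₂ h₃ ≡ RHS M p t
theorem2p6 n M p t h₁ h₂ h₃ = begin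
  ((- 1ℚ) ^ rk M * Y M (1ℚ + p) (- t) h₁ h₂ - t ^ rk M) * 1/ (1ℚ + t)
    ≡⟨ cong (_* 1/ (1ℚ + t)) ([-1]^d*Y-t^d≡[1+t]*RHS M p t h₁ h₂) ⟩
  ((1ℚ + t) * RHS M p t) * 1/ (1ℚ + t)
    ≡⟨ [x*y]*1/x≡y (1ℚ + t) (RHS M p t) ⟩
  RHS M p t ∎
  where
  open ≡-Reasoning
  instance _ = ≢-nonZero h₃
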